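{- Let $M=(S,P,I,AP,L)$ be a finite generalized possibilistic Kripke structure and let $s\in S$. Then $$r_P(s)=\bigvee\{P^+(s,t)\wedge P^+(t,t)\mid t\in S\},$$ i.e., in matrix notation $r_P=P^+\circ D$, where $D$ is the column vector $(P^+(t,t))_{t\in S}$. In particular, $P$ is normal (i.e. $\bigvee_{t\in S}P(s,t)=1$ for every $s\in S$) if and only if $r_P(s)=1$ for every state $s\in S$.
   Context: A generalized possibilistic Kripke structure (GPKS) is a tuple $M=(S,P,I,AP,L)$ where $S$ is a countable nonempty set of states, $P:S\times S\to[0,1]$ is an arbitrary function (transition possibility function), $I:S\to[0,1]$ is an arbitrary function (initial distribution), $AP$ is a set of atomic propositions and $L:S\times AP\to[0,1]$ is a labeling function; no normalization conditions are imposed. $M$ is finite if $S$ and $AP$ are finite. $\vee,\wedge$ denote supremum and infimum in $[0,1]$. The function $r_P:S\to[0,1]$ is defined by $r_P(s)=\bigvee\{P(s,s_1)\wedge P(s_1,s_2)\wedge P(s_2,s_3)\wedge\cdots\mid s_1,s_2,\ldots\in S\}$ (supremum over all infinite sequences of states). $P$ is viewed as an $S\times S$ fuzzy matrix; $\circ$ denotes max-min composition of fuzzy matrices ($(A\circ B)(s,t)=\bigvee_u A(s,u)\wedge B(u,t)$), $P^1=P$, $P^{k+1}=P^k\circ P$, and the transitive closure is $P^+=\bigvee_{k\ge1}P^k$ (which equals $P\vee P^2\vee\cdots\vee P^{|S|}$ for finite $S$). -}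

module Defs where

open import Level using (0ℓ)
open import Data.Nat using (ℕ; zero; suc)
open import Data.Fin using (Fin)
open import Data.Bool using (Bool; true; false)
open import Data.Product using (Σ; _×_)
open import Relation.Binary.PropositionalEquality using (_≡_)
open import Relation.Binary.Structures using (IsTotalOrder)

-- Agda's standard library has
-- no real numbers, so the unit interval is modelled abstractly by the
-- order-theoretic structure the paper actually uses: a complete chain, i.e.
-- a totally ordered set in which every family (indexed by any type, in
-- particular by infinite sequences of states) has a supremum and an infimum,
-- together with its least element 0 and greatest element 1.
-- ([0,1] with the usual order is an instance.)
record CompleteChain : Set₁ where
  field
    Carrier : Set
    _≤_     : Carrier → Carrier → Set
    isTotalOrder : IsTotalOrder _≡_ _≤_
    ⋁       : {I : Set} → (I → Carrier) → Carrier
    ⋁-upper : {I : Set} (f : I → Carrier) (i : I) → f i ≤ ⋁ f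
    ⋁-least : {I : Set} (f : I → Carrier) (b : Carrier) →
              ((i : I) → f i ≤ b) → ⋁ f ≤ b
    ⋀       : {I : Set} → (I → Carrier) → Carrier
    ⋀-lower : {I : Set} (f : I → Carrier) (i : I) → ⋀ f ≤ f i
    ⋀-great : {I : Set} (f : I → Carrier) (b : Carrier) →
              ((i : I) → b ≤ f i) → b ≤ ⋀ f
    𝟘       : Carrier
    𝟙       : Carrier
    𝟘-min   : (x : Carrier) → 𝟘 ≤ x
    𝟙-max   : (x : Carrier) → x ≤ 𝟙

  _∨_ : Carrier → Carrier → Carrier
  x ∨ y = ⋁ (λ (b : Bool) → if′ b x y)
    where
    if′ : Bool → Carrier → Carrier → Carrier
    if′ true  a _ = a
    if′ false _ c = c

  _∧_ : Carrier → Carrier → Carrier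
  x ∧ y = ⋀ (λ (b : Bool) → if′ b x y)
    where
    if′ : Bool → Carrier → Carrier → Carrier
    if′ true  a _ = a
    if′ false _ c = c

-- A finite generalized possibilistic Kripke structure over the value
-- domain V: states S = Fin n (n ≥ 1, i.e. S nonempty), atomic propositions
-- AP = Fin a; no normalization conditions.
record GPKS (V : CompleteChain) (n a : ℕ) : Set where
  open CompleteChain V
  field
    P : Fin n → Fin n → Carrier
    I : Fin n → Carrier
    L : Fin n → Fin a → Carrier

module FuzzyMatrix (V : CompleteChain) {n : ℕ} where
  open CompleteChain V

  Matrix : Set
  Matrix = Fin n → Fin n → Carrier

  _∘_ : Matrix → Matrix → Matrix
  (A ∘ B) s t = ⋁ (λ u → A s u ∧ B u t)

  -- powers: P^1 = P, P^(k+1) = P^k ∘ P   (pow P k = P^(k+1))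
  pow : Matrix → ℕ → Matrix
  pow P zero    = P
  pow P (suc k) = pow P k ∘ P

  _⁺ : Matrix → Matrix
  (P ⁺) s t = ⋁ (λ (k : ℕ) → pow P k s t)

  -- r_P(s) = ⋁ { P(s,s1) ∧ P(s1,s2) ∧ ... | s1,s2,... ∈ S }
  -- the path s = s0, s1, s2, ... with s_{k+1} = σ k
  path : Fin n → (ℕ → Fin n) → ℕ → Fin n
  path s σ zero    = s
  path s σ (suc k) = σ k

  r : Matrix → Fin n → Carrier
  r P s = ⋁ (λ (σ : ℕ → Fin n) → ⋀ (λ (k : ℕ) → P (path s σ k) (path s σ (suc k))))

  Normal : Matrix → Set
  Normal P = (s : Fin n) → ⋁ (λ t → P s t) ≡ 𝟙

-- Fix a threshold v.  A v-walk is a sequence of states whose steps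
-- all have possibility ≥ v; a v-run is an infinite v-walk.  Everything is
-- reduced to combinatorics of such walks:
--   * P^(k+1)(s,t) is the strength of the best walk of k+1 steps from s to t
--     (finite suprema are attained in a chain);
--   * by the pigeonhole principle a walk can be shortened to at most n steps
--     by cutting out cycles, so P⁺(s,t) is attained by a single walk;
--   * (≤) every run visits some state t twice within its first n+1 states,
--     which gives a walk s ⇝ t and a cycle t ⇝ t as strong as the run;
--   * (≥) conversely, a walk s ⇝ t followed by a cycle at t repeated
--     forever is a run as strong as P⁺(s,t) ∧ P⁺(t,t).
-- Normality is handled directly: greedily following maximal steps yields a
-- run of strength 1, and every run starts with a step out of s.
module Submission where

open import Defs
open import Data.Nat using (ℕ; zero; suc; _+_; _∸_; _<_; z≤n; s≤s; NonZero)
  renaming (_≤_ to _≤ℕ_)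
import Data.Nat.Properties as ℕ
open import Data.Nat.DivMod using (_%_; _/_; m≡m%n+[m/n]*n; [m+kn]%n≡m%n; m%n<n; m<n⇒m%n≡m; n%n≡0)
open import Data.Nat.Induction using (<-rec)
open import Data.Fin using (Fin; toℕ; fromℕ<) renaming (zero to fzero; suc to fsuc)
open import Data.Fin.Properties using (pigeonhole; toℕ-fromℕ<; toℕ<n)
open import Data.Bool using (true; false)
open import Data.Product using (Σ; _×_; _,_; proj₁; proj₂)
open import Data.Sum using (inj₁; inj₂)
open import Relation.Nullary using (yes; no)
open import Relation.Binary.PropositionalEquality
  using (_≡_; refl; sym; trans; cong; subst; subst₂)
open import Relation.Binary.Structures using (IsTotalOrder)
open import Function.Bundles using (_⇔_; mk⇔)

suc-mod : ∀ m d .{{_ : NonZero d}} → suc m % d ≡ suc (m % d) % d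
suc-mod m d = trans (cong (λ x → suc x % d) (m≡m%n+[m/n]*n m d))
                    ([m+kn]%n≡m%n (suc (m % d)) (m / d) d)

module ChainFacts (V : CompleteChain) where
  open CompleteChain V
  open IsTotalOrder isTotalOrder using (total) renaming (refl to ≤-refl; trans to ≤-trans)

  ∧-lowerˡ : ∀ x y → (x ∧ y) ≤ x
  ∧-lowerˡ x y = ⋀-lower _ true

  ∧-lowerʳ : ∀ x y → (x ∧ y) ≤ y
  ∧-lowerʳ x y = ⋀-lower _ false

  ∧-greatest : ∀ {z x y} → z ≤ x → z ≤ y → z ≤ (x ∧ y)
  ∧-greatest z≤x z≤y = ⋀-great _ _ λ { true → z≤x ; false → z≤y }

  max-attained : ∀ {m} (g : Fin (suc m) → Carrier) → Σ (Fin (suc m)) λ u → ∀ v → g v ≤ g u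
  max-attained {zero} g = fzero , λ { fzero → ≤-refl }
  max-attained {suc m} g with max-attained (λ v → g (fsuc v))
  ... | u , max with total (g fzero) (g (fsuc u))
  ... | inj₁ le = fsuc u , λ { fzero → le ; (fsuc v) → max v }
  ... | inj₂ ge = fzero , λ { fzero → ≤-refl ; (fsuc v) → ≤-trans (max v) ge }

  ⋁-attained : ∀ {k} → Fin k → (g : Fin k → Carrier) → Σ (Fin k) λ u → ⋁ g ≤ g u
  ⋁-attained {suc m} _ g with max-attained g
  ... | u , max = u , ⋁-least g (g u) max

module Walks (V : CompleteChain) {n : ℕ} (P : Fin n → Fin n → CompleteChain.Carrier V) where
  open CompleteChain V
  open FuzzyMatrix V {n}
  open ChainFacts V
  open IsTotalOrder isTotalOrder using (antisym) renaming (refl to ≤-refl; trans to ≤-trans)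

  Seq : Set
  Seq = ℕ → Fin n

  variable
    u v : Carrier
    i j k l : ℕ
    s t x y : Fin n

  Edge : Carrier → Seq → ℕ → Set
  Edge v w m = v ≤ P (w m) (w (suc m))

  Strong : Carrier → Seq → ℕ → Set
  Strong v w ℓ = ∀ m → m < ℓ → Edge v w m

  record Walk (v : Carrier) (ℓ : ℕ) (s t : Fin n) : Set where
    field
      steps  : Seq
      start  : steps 0 ≡ s
      end    : steps ℓ ≡ t
      strong : Strong v steps ℓ

  record Run (v : Carrier) (s : Fin n) : Set where
    field
      steps : Seq
      start : steps 0 ≡ s
      edges : ∀ m → Edge v steps m

  weaken : u ≤ v → Walk v l s t → Walk u l s t
  weaken u≤v W = record
    { steps  = Walk.steps W
    ; start  = Walk.start W
    ; end    = Walk.end W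
    ; strong = λ m m<l → ≤-trans u≤v (Walk.strong W m m<l)
    }

  retarget : s ≡ x → t ≡ y → Walk v l s t → Walk v l x y
  retarget = subst₂ (Walk _ _)

  edge : v ≤ P s t → Walk v 1 s t
  edge {s = s} {t = t} v≤Pst = record
    { steps  = λ { zero → s ; (suc _) → t }
    ; start  = refl
    ; end    = refl
    ; strong = λ { zero _ → v≤Pst ; (suc _) (s≤s ()) }
    }

  segment : (w : Seq) → Strong v w j → i ≤ℕ j → Walk v (j ∸ i) (w i) (w j)
  segment {i = i} w strong i≤j = record
    { steps  = λ m → w (m + i)
    ; start  = refl
    ; end    = cong w (ℕ.m∸n+n≡m i≤j)
    ; strong = λ m m< → strong (m + i) (subst (m + i <_) (ℕ.m∸n+n≡m i≤j) (ℕ.+-monoˡ-< i m<))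
    }

  -- The first j+1 states of α followed by β from its second state on.
  splice : Seq → ℕ → Seq → Seq
  splice α zero    β         = β
  splice α (suc j) β zero    = α 0
  splice α (suc j) β (suc m) = splice (λ m → α (suc m)) j β m

  splice-start : ∀ α j β → α j ≡ β 0 → splice α j β 0 ≡ α 0
  splice-start α zero    β joint = sym joint
  splice-start α (suc j) β joint = refl

  splice-end : ∀ α j β m → splice α j β (j + m) ≡ β m
  splice-end α zero    β m = refl
  splice-end α (suc j) β m = splice-end (λ m → α (suc m)) j β m

  splice-strong : ∀ α j β l → α j ≡ β 0 → Strong v α j → Strong v β l →
                  Strong v (splice α j β) (j + l)
  splice-strong α zero β l _ _ strongβ = strongβ
  splice-strong {v = v} α (suc j) β l joint strongα _ zero _ =
    subst (λ y → v ≤ P (α 0) y) (sym (splice-start (λ m → α (suc m)) j β joint)) (strongα 0 (s≤s z≤n))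
  splice-strong α (suc j) β l joint strongα strongβ (suc m) (s≤s m<) =
    splice-strong (λ m → α (suc m)) j β l joint (λ k k< → strongα (suc k) (s≤s k<)) strongβ m m<

  append : Walk v j s x → Walk v l x t → Walk v (j + l) s t
  append {j = j} {l = l} A B = record
    { steps  = splice α j β
    ; start  = trans (splice-start α j β joint) (Walk.start A)
    ; end    = trans (splice-end α j β l) (Walk.end B)
    ; strong = splice-strong α j β l joint (Walk.strong A) (Walk.strong B)
    }
    where
    α β : Seq
    α = Walk.steps A
    β = Walk.steps B
    joint : α j ≡ β 0
    joint = trans (Walk.end A) (sym (Walk.start B))

  append-run : Walk v j s x → Run v x → Run v s
  append-run {j = j} A R = record
    { steps = splice α j β
    ; start = trans (splice-start α j β joint) (Walk.start A)
    ; edges = λ m → splice-strong α j β (suc m) joint (Walk.strong A) (λ k _ → Run.edges R k)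
                                  m (ℕ.m≤n+m (suc m) j)
    }
    where
    α β : Seq
    α = Walk.steps A
    β = Run.steps R
    joint : α j ≡ β 0
    joint = trans (Walk.end A) (sym (Run.start R))

  loop-run : Walk v (suc k) t t → Run v t
  loop-run {v = v} {k = k} C = record
    { steps = λ m → w (m % suc k)
    ; start = Walk.start C
    ; edges = λ m → subst (λ y → v ≤ P (w (m % suc k)) (w y)) (sym (suc-mod m (suc k)))
                          (around (m % suc k) (m%n<n m (suc k)))
    }
    where
    w : Seq
    w = Walk.steps C
    around : ∀ r → r < suc k → v ≤ P (w r) (w (suc r % suc k))
    around r r<1+k with ℕ.m≤n⇒m<n∨m≡n (ℕ.<⇒≤pred r<1+k)
    ... | inj₁ r<k = subst (λ y → v ≤ P (w r) (w y)) (sym (m<n⇒m%n≡m (s≤s r<k))) (Walk.strong C r r<1+k)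
    ... | inj₂ refl = subst (λ y → v ≤ P (w k) y) wrap (Walk.strong C k r<1+k)
      where
      wrap : w (suc k) ≡ w (suc k % suc k)
      wrap = trans (Walk.end C) (trans (sym (Walk.start C)) (cong w (sym (n%n≡0 (suc k)))))

  repetition : (w : Seq) → Σ ℕ λ i → Σ ℕ λ j → i < j × j ≤ℕ n × w i ≡ w j
  repetition w with pigeonhole (ℕ.n<1+n n) (λ x → w (toℕ x))
  ... | i , j , i<j , same = toℕ i , toℕ j , i<j , ℕ.<⇒≤pred (toℕ<n j) , same

  cut-cycle : (W : Walk v l s t) → i ≤ℕ j → j ≤ℕ l → Walk.steps W i ≡ Walk.steps W j →
              Walk v (i + (l ∸ j)) s t
  cut-cycle {v = v} {l = l} {i = i} {j = j} W i≤j j≤l same =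
    append (retarget (Walk.start W) refl prefix) (retarget (sym same) (Walk.end W) suffix)
    where
    prefix : Walk v i (Walk.steps W 0) (Walk.steps W i)
    prefix = segment (Walk.steps W) (λ m m<i → Walk.strong W m (ℕ.<-≤-trans m<i (ℕ.≤-trans i≤j j≤l))) z≤n
    suffix : Walk v (l ∸ j) (Walk.steps W j) (Walk.steps W l)
    suffix = segment (Walk.steps W) (Walk.strong W) j≤l

  shorten : ∀ k → Walk v (suc k) s t → Σ ℕ λ k′ → k′ < n × Walk v (suc k′) s t
  shorten {v = v} {s = s} {t = t} = <-rec Shortenable step
    where
    Shortenable : ℕ → Set
    Shortenable k = Walk v (suc k) s t → Σ ℕ λ k′ → k′ < n × Walk v (suc k′) s t
    step : ∀ k → (∀ {k′} → k′ < k → Shortenable k′) → Shortenable k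
    step k rec W with k ℕ.<? n
    ... | yes k<n = k , k<n , W
    ... | no k≮n with repetition (Walk.steps W)
    ... | i , j , i<j , j≤n , same =
      rec shorter (subst (λ ℓ → Walk v ℓ s t) length
                         (cut-cycle W (ℕ.<⇒≤ i<j) (ℕ.m≤n⇒m≤1+n j≤k) same))
      where
      j≤k : j ≤ℕ k
      j≤k = ℕ.≤-trans j≤n (ℕ.≮⇒≥ k≮n)
      length : i + (suc k ∸ j) ≡ suc (i + (k ∸ j))
      length = trans (cong (i +_) (ℕ.+-∸-assoc 1 j≤k)) (ℕ.+-suc i (k ∸ j))
      shorter : i + (k ∸ j) < k
      shorter = subst (i + (k ∸ j) <_) (ℕ.m+[n∸m]≡n j≤k) (ℕ.+-monoˡ-< (k ∸ j) i<j)

  strong⇒pow : ∀ (w : Seq) k → Strong v w (suc k) → v ≤ pow P k (w 0) (w (suc k))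
  strong⇒pow w zero strong = strong 0 (s≤s z≤n)
  strong⇒pow w (suc k) strong =
    ≤-trans (∧-greatest (strong⇒pow w k λ m m< → strong m (ℕ.m<n⇒m<1+n m<))
                        (strong (suc k) ℕ.≤-refl))
            (⋁-upper (λ y → pow P k (w 0) y ∧ P y (w (suc (suc k)))) (w (suc k)))

  walk⇒pow : Walk v (suc k) s t → v ≤ pow P k s t
  walk⇒pow {k = k} W =
    subst₂ (λ a b → _ ≤ pow P k a b) (Walk.start W) (Walk.end W) (strong⇒pow (Walk.steps W) k (Walk.strong W))

  walk⇒closure : 0 < l → Walk v l s t → v ≤ (P ⁺) s t
  walk⇒closure {l = suc k} _ W = ≤-trans (walk⇒pow W) (⋁-upper _ k)

  pow⇒walk : ∀ k s t → Walk (pow P k s t) (suc k) s t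
  pow⇒walk zero s t = edge ≤-refl
  pow⇒walk (suc k) s t with ⋁-attained s (λ y → pow P k s y ∧ P y t)
  ... | y , best = subst (λ ℓ → Walk (pow P (suc k) s t) ℓ s t) (ℕ.+-comm (suc k) 1)
                         (append (weaken (≤-trans best (∧-lowerˡ _ _)) (pow⇒walk k s y))
                                 (edge (≤-trans best (∧-lowerʳ _ _))))

  pow-bounded : ∀ k s t → Σ ℕ λ k′ → k′ < n × pow P k s t ≤ pow P k′ s t
  pow-bounded k s t with shorten k (pow⇒walk k s t)
  ... | k′ , k′<n , W = k′ , k′<n , walk⇒pow W

  closure-attained : ∀ s t → Σ ℕ λ k → (P ⁺) s t ≤ pow P k s t
  closure-attained s t with ⋁-attained s (λ j → pow P (toℕ j) s t)
  ... | j , best = toℕ j , ⋁-least _ _ bound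
    where
    bound : ∀ k → pow P k s t ≤ pow P (toℕ j) s t
    bound k with pow-bounded k s t
    ... | k′ , k′<n , le =
      ≤-trans le (≤-trans (subst (λ y → pow P y s t ≤ ⋁ (λ j → pow P (toℕ j) s t)) (toℕ-fromℕ< k′<n)
                                 (⋁-upper _ (fromℕ< k′<n)))
                          best)

  closure-walk : ∀ s t → Σ ℕ λ k → Walk ((P ⁺) s t) (suc k) s t
  closure-walk s t with closure-attained s t
  ... | k , le = k , weaken le (pow⇒walk k s t)

  run⇒r : Run v s → v ≤ r P s
  run⇒r {v = v} {s = s} R = ≤-trans (⋀-great _ _ along) (⋁-upper _ σ)
    where
    σ : Seq
    σ m = Run.steps R (suc m)
    along : ∀ k → v ≤ P (path s σ k) (path s σ (suc k))
    along zero    = subst (λ y → v ≤ P y (σ 0)) (Run.start R) (Run.edges R 0)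
    along (suc k) = Run.edges R (suc k)

  path-run : (σ : Seq) → Run (⋀ (λ k → P (path s σ k) (path s σ (suc k)))) s
  path-run {s = s} σ = record { steps = path s σ ; start = refl ; edges = ⋀-lower _ }

  run⇒lasso : Run v s → v ≤ ⋁ (λ t → (P ⁺) s t ∧ (P ⁺) t t)
  run⇒lasso {v = v} {s = s} R with repetition (Run.steps R)
  ... | i , j , i<j , _ , same = ≤-trans (∧-greatest toCycle onCycle) (⋁-upper _ (w j))
    where
    w : Seq
    w = Run.steps R
    strong : ∀ {ℓ} → Strong v w ℓ
    strong m _ = Run.edges R m
    toCycle : v ≤ (P ⁺) s (w j)
    toCycle = walk⇒closure (ℕ.≤-trans (s≤s z≤n) i<j) (retarget (Run.start R) refl (segment w strong z≤n))
    onCycle : v ≤ (P ⁺) (w j) (w j)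
    onCycle = walk⇒closure (ℕ.m<n⇒0<n∸m i<j) (retarget same refl (segment w strong (ℕ.<⇒≤ i<j)))

  lasso⇒r : ∀ s t → ((P ⁺) s t ∧ (P ⁺) t t) ≤ r P s
  lasso⇒r s t with closure-walk s t | closure-walk t t
  ... | _ , toCycle | _ , cycle =
    run⇒r (append-run (weaken (∧-lowerˡ _ _) toCycle) (loop-run (weaken (∧-lowerʳ _ _) cycle)))

  r-lasso : ∀ s → r P s ≡ ⋁ (λ t → (P ⁺) s t ∧ (P ⁺) t t)
  r-lasso s = antisym (⋁-least _ _ (λ σ → run⇒lasso (path-run σ))) (⋁-least _ _ (lasso⇒r s))

  -- Every path starts with a step out of s.
  r≤first-step : ∀ s → r P s ≤ ⋁ (P s)
  r≤first-step s = ⋁-least _ _ λ σ → ≤-trans (⋀-lower _ 0) (⋁-upper _ (σ 0))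

  normal-run : Normal P → ∀ s → Run 𝟙 s
  normal-run normal s = record { steps = greedy ; start = refl ; edges = λ m → best (greedy m) }
    where
    next : Fin n → Fin n
    next x = proj₁ (⋁-attained x (P x))
    best : ∀ x → 𝟙 ≤ P x (next x)
    best x = subst (_≤ P x (next x)) (normal x) (proj₂ (⋁-attained x (P x)))
    greedy : Seq
    greedy zero    = s
    greedy (suc m) = next (greedy m)

  normal⇔r≡𝟙 : Normal P ⇔ ((s : Fin n) → r P s ≡ 𝟙)
  normal⇔r≡𝟙 = mk⇔
    (λ normal s → antisym (𝟙-max _) (run⇒r (normal-run normal s)))
    (λ r≡𝟙 s → antisym (𝟙-max _) (subst (_≤ ⋁ (P s)) (r≡𝟙 s) (r≤first-step s)))

proposition1 : (V : CompleteChain) (n a : ℕ) → 0 < n → (M : GPKS V n a) →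
    let open CompleteChain V
        open FuzzyMatrix V {n}
        P = GPKS.P M
    in ((s : Fin n) → r P s ≡ ⋁ (λ t → (P ⁺) s t ∧ (P ⁺) t t))
       × (Normal P ⇔ ((s : Fin n) → r P s ≡ 𝟙))
proposition1 V n a _ M = r-lasso , normal⇔r≡𝟙
  where open Walks V (GPKS.P M)
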